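{- Let $\sim$ be any equivalence relation on the class of equivalence structures on $\omega$ and let $M$ be a $\mathbf{Txt}\mathbf{Ex}_{\sim}$-learner. Then there is a text locking $\mathbf{Txt}\mathbf{Ex}_{\sim}$-learner $M'$ which $\mathbf{Txt}\mathbf{Ex}_{\sim}$-learns at least all structures $\mathbf{Txt}\mathbf{Ex}_{\sim}$-learned by $M$.
   Context: An equivalence structure is $\mathcal{A}=(\omega,E)$ with $E$ an equivalence relation on $\omega$; an $\omega$-presentation of $\mathcal{M}$ is an equivalence structure with domain $\omega$ isomorphic to $\mathcal{M}$. Fix a computable sequence $(E_i)_{i\in\omega}$ of equivalence relations on $\omega$ such that every infinite computable equivalence structure is isomorphic to some $\mathcal{M}_i=(\omega,E_i)$; a conjecture $e$ denotes $\mathcal{M}_e$. A text for $\mathcal{A}=(\omega,E)$ is $T:\omega\to\omega^2\cup\{\#\}$ with $\mathrm{range}(T)\setminus\{\#\}=E$ ($\#$ a pause symbol); $T[n]=T(0),\dots,T(n-1)$. A learner is an arbitrary function from finite sequences to $\omega\cup\{?\}$. $M$ $\mathbf{Txt}\mathbf{Ex}_{\sim}$-learns $\mathcal{A}$ if for every $\omega$-presentation $\mathcal{A}^*$ of $\mathcal{A}$ and every text $T$ for $\mathcal{A}^*$ there is $e$ with $M(T[n])=e$ for all but finitely many $n$ and $\mathcal{A}^*\sim\mathcal{M}_e$. A finite sequence of positive data describes a finite part of $\mathcal{A}$ if all its non-pause entries are pairs in $E$. Such a $\sigma$ is a weak text locking sequence of $M$ on $\mathcal{A}$ if $M(\tau)=M(\sigma)$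 for every $\tau\supseteq\sigma$ of positive data describing a finite part of $\mathcal{A}$. $M$ is text locking on $\mathcal{A}$ if for every text $T$ for $\mathcal{A}$ there is $n$ such that $T[n]$ is a weak text locking sequence of $M$ on $\mathcal{A}$; $M$ is text locking if it is text locking on every structure it $\mathbf{Txt}\mathbf{Ex}_{\sim}$-learns. -}

module Defs where

open import Data.Bool using (Bool; true; false; T)
open import Data.Nat using (ℕ; _≤_)
open import Data.Product using (Σ; _×_; _,_; ∃; ∃-syntax)
open import Data.Maybe using (Maybe; just; nothing)
open import Data.List using (List; []; _∷_; _++_)
open import Data.List.Relation.Unary.All using (All)
open import Data.Unit using (⊤)
open import Function.Definitions using (Bijective)
open import Relation.Binary.PropositionalEquality using (_≡_)
open import Relation.Binary.Structures using (IsEquivalence)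

-- An equivalence structure (ω, E).  E ⊆ ω² is given by its characteristic
-- function (classically every subset of ω² is of this form).
record EqStr : Set where
  field
    rel   : ℕ → ℕ → Bool
    isEq  : IsEquivalence (λ x y → T (rel x y))
open EqStr public

_≅_ : EqStr → EqStr → Set
A ≅ B = Σ (ℕ → ℕ) λ f → Bijective _≡_ _≡_ f ×
          (∀ x y → rel A x y ≡ rel B (f x) (f y))

-- A datum: either the pause symbol # (nothing) or a pair (x , y).
Datum : Set
Datum = Maybe (ℕ × ℕ)

FinSeq : Set
FinSeq = List Datum

Text : Set
Text = ℕ → Datum

IsTextFor : EqStr → Text → Set
IsTextFor A t =
  (∀ n x y → t n ≡ just (x , y) → rel A x y ≡ true) ×
  (∀ x y → rel A x y ≡ true → ∃[ n ] t n ≡ just (x , y))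

prefix : Text → ℕ → FinSeq
prefix t ℕ.zero    = []
prefix t (ℕ.suc n) = prefix t n ++ (t n ∷ [])

-- Learner: arbitrary function from finite sequences to ω ∪ {?} (? = nothing).
Learner : Set
Learner = FinSeq → Maybe ℕ

-- M TxtEx_∼-learns A, where Ms e is the structure M_e denoted by conjecture e.
TxtExLearns : (Ms : ℕ → EqStr) (_∼_ : EqStr → EqStr → Set) →
              Learner → EqStr → Set
TxtExLearns Ms _∼_ M A =
  ∀ (A* : EqStr) → A* ≅ A → ∀ (t : Text) → IsTextFor A* t →
    ∃[ e ] ((∃[ N ] (∀ n → N ≤ n → M (prefix t n) ≡ just e)) × (A* ∼ Ms e))

DatumIn : EqStr → Datum → Set
DatumIn A nothing        = ⊤
DatumIn A (just (x , y)) = rel A x y ≡ true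

Describes : EqStr → FinSeq → Set
Describes A σ = All (DatumIn A) σ

WeakTextLocking : Learner → EqStr → FinSeq → Set
WeakTextLocking M A σ =
  Describes A σ ×
  (∀ (ρ : FinSeq) → Describes A (σ ++ ρ) → M (σ ++ ρ) ≡ M σ)

TextLockingOn : Learner → EqStr → Set
TextLockingOn M A =
  ∀ (t : Text) → IsTextFor A t → ∃[ n ] WeakTextLocking M A (prefix t n)

TextLocking : (Ms : ℕ → EqStr) (_∼_ : EqStr → EqStr → Set) → Learner → Set
TextLocking Ms _∼_ M = ∀ (A : EqStr) → TxtExLearns Ms _∼_ M A → TextLockingOn M A

-- M′ follows M only through locking sequences.  On input σ it searches a finite, growing list
-- of candidates for the first τ that looks locking for M given the data of σ (τ uses only
-- data of σ, and no extension of τ by data of σ changes M's conjecture), and outputs M τ.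
-- Along a text for A, a candidate that is not a weak locking sequence on A is eventually
-- refuted by the text, while a genuine one is accepted forever; so once M has some weak
-- locking sequence on A, the choice of τ stabilises on a genuine one, and M′ converges to
-- M's limit on the text τ followed by the text for A.  M has such a sequence on every A
-- it learns (Blum and Blum).  Conversely, if M′ converges on a text for A, its choice of τ
-- has stabilised on a weak locking sequence of M, and from then on M′ is constant on every
-- extension consistent with A.

module Submission where

open import Defs
open import Level using (0ℓ)
open import Data.Nat using (ℕ)
open import Data.Product using (_×_; ∃-syntax)
open import Axiom.ExcludedMiddle using (ExcludedMiddle)
open import Relation.Binary.Structures using (IsEquivalence)

open import Data.Nat using (zero; suc; _+_; _≤_; _<_; _⊔_; z≤n; s≤s)
open import Data.Nat.Properties
open import Data.Product using (∃; _,_; proj₁; proj₂)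
open import Data.Sum using (_⊎_; inj₁; inj₂)
open import Data.Maybe using (Maybe; just; nothing; _>>=_)
open import Data.List
  using (List; []; _∷_; _++_; _∷ʳ_; length; map; find; cartesianProduct; cartesianProductWith; upTo)
open import Data.List.Properties using (++-assoc; ++-identityʳ; length-++; length-++-≤ˡ; length-++-sucʳ)
open import Data.List.Relation.Unary.All as All using (All; []; _∷_)
import Data.List.Relation.Unary.All.Properties as All
open import Data.List.Relation.Unary.Any using (Any; here; there)
open import Data.List.Membership.Propositional using (_∈_; lose)
open import Data.List.Membership.Propositional.Properties
  using (∈-++⁺ˡ; ∈-++⁺ʳ; ∈-map⁺; ∈-cartesianProduct⁺; ∈-cartesianProductWith⁺; ∈-upTo⁺)
open import Data.Bool using (true)
open import Data.Unit using (⊤; tt)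
open import Data.Empty using (⊥-elim)
open import Function using (id; _∘_)
open import Function.Construct.Identity using (bijective)
open import Relation.Unary using (Decidable)
open import Relation.Nullary using (Dec; yes; no; ¬_)
open import Relation.Nullary.Decidable using (decidable-stable)
open import Relation.Binary.PropositionalEquality using (_≡_; _≢_; refl; sym; trans; cong; cong₂; subst)

module _ {X : Set} where

  infix 4 _≼_

  _≼_ : List X → List X → Set
  l ≼ σ = ∃ λ r → σ ≡ l ++ r

  ≼-refl : ∀ {l} → l ≼ l
  ≼-refl {l} = [] , sym (++-identityʳ l)

  ≼-++ : ∀ {l} r → l ≼ l ++ r
  ≼-++ r = r , refl

  ≼-trans : ∀ {l m σ} → l ≼ m → m ≼ σ → l ≼ σ
  ≼-trans {l} (r , refl) (r′ , refl) = r ++ r′ , ++-assoc l r r′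

  ∈-≼ : ∀ {x l σ} → x ∈ l → l ≼ σ → x ∈ σ
  ∈-≼ x∈ (r , refl) = ∈-++⁺ˡ x∈

  ≼-All : ∀ {P : X → Set} {l σ} → l ≼ σ → All P σ → All P l
  ≼-All {l = l} (r , refl) = All.++⁻ˡ l

  ≼-length : ∀ {l σ} → l ≼ σ → length l ≤ length σ
  ≼-length {l} (r , refl) = length-++-≤ˡ l

  ≼-chain : (f : ℕ → List X) → (∀ k → f k ≼ f (suc k)) → ∀ {k k′} → k ≤ k′ → f k ≼ f k′
  ≼-chain f step {k} {k′} k≤k′ with m≤n⇒m<n∨m≡n k≤k′
  ... | inj₂ refl = ≼-refl
  ≼-chain f step {k} {suc k′} _ | inj₁ (s≤s k≤k′) = ≼-trans (≼-chain f step k≤k′) (step k′)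

  dropLast : List X → List X
  dropLast []           = []
  dropLast (x ∷ [])     = []
  dropLast (x ∷ y ∷ xs) = x ∷ dropLast (y ∷ xs)

  dropLast-++-∷ : ∀ l y r → dropLast (l ++ y ∷ r) ≡ l ++ dropLast (y ∷ r)
  dropLast-++-∷ []          y r = refl
  dropLast-++-∷ (x ∷ [])    y r = refl
  dropLast-++-∷ (x ∷ z ∷ l) y r = cong (x ∷_) (dropLast-++-∷ (z ∷ l) y r)

  dropLast-∷ʳ : ∀ l y → dropLast (l ∷ʳ y) ≡ l
  dropLast-∷ʳ l y = trans (dropLast-++-∷ l y []) (++-identityʳ l)

  dropLast-≼ : ∀ {l y σ} → l ∷ʳ y ≼ σ → l ≼ dropLast σ
  dropLast-≼ {l} {y} (r , refl) =
    dropLast (y ∷ r) , trans (cong dropLast (++-assoc l (y ∷ []) r)) (dropLast-++-∷ l y r)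

  dropLast-All : ∀ {P : X → Set} {l} → All P l → All P (dropLast l)
  dropLast-All []             = []
  dropLast-All (_  ∷ [])      = []
  dropLast-All (px ∷ py ∷ pl) = px ∷ dropLast-All (py ∷ pl)

  module _ {P : X → Set} (P? : Decidable P) where

    find-sound : ∀ {l x} → find P? l ≡ just x → P x
    find-sound {y ∷ l} eq with P? y
    find-sound {y ∷ l} refl | yes py = py
    ... | no _ = find-sound {l} eq

    find-++ : ∀ {l x} r → find P? l ≡ just x → find P? (l ++ r) ≡ just x
    find-++ {y ∷ l} r eq with P? y
    ... | yes _ = eq
    ... | no _  = find-++ {l} r eq

    find-≼ : ∀ {l l′ x} → find P? l ≡ just x → l ≼ l′ → find P? l′ ≡ just x
    find-≼ {l} found (r , refl) = find-++ {l} r found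

    find-accept : ∀ {x l} → P x → find P? (x ∷ l) ≡ just x
    find-accept {x} px with P? x
    ... | yes _  = refl
    ... | no ¬px = ⊥-elim (¬px px)

    find-reject : ∀ {x l} → ¬ P x → find P? (x ∷ l) ≡ find P? l
    find-reject {x} ¬px with P? x
    ... | yes px = ⊥-elim (¬px px)
    ... | no _   = refl

-- Beyond the end of a sequence we read pauses.
nth : FinSeq → ℕ → Datum
nth []      n       = nothing
nth (d ∷ σ) zero    = d
nth (d ∷ σ) (suc n) = nth σ n

nth-++ˡ : ∀ l r {n} → n < length l → nth (l ++ r) n ≡ nth l n
nth-++ˡ (d ∷ l) r {zero}  _         = refl
nth-++ˡ (d ∷ l) r {suc n} (s≤s n<) = nth-++ˡ l r n<

nth-length : ∀ l d r → nth (l ++ d ∷ r) (length l) ≡ d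
nth-length []      d r = refl
nth-length (_ ∷ l) d r = nth-length l d r

nth-All : ∀ {P : Datum → Set} → P nothing → ∀ {σ} → All P σ → ∀ n → P (nth σ n)
nth-All p₀ []       n       = p₀
nth-All p₀ (p ∷ ps) zero    = p
nth-All p₀ (p ∷ ps) (suc n) = nth-All p₀ ps n

prefix-length : ∀ t n → length (prefix t n) ≡ n
prefix-length t zero    = refl
prefix-length t (suc n) = trans (length-++ (prefix t n)) (trans (cong (_+ 1) (prefix-length t n)) (+-comm n 1))

prefix-≼ : ∀ t {m n} → m ≤ n → prefix t m ≼ prefix t n
prefix-≼ t = ≼-chain (prefix t) (λ n → ≼-++ (t n ∷ []))

prefix-suc : ∀ t n → prefix t (suc n) ≡ t 0 ∷ prefix (λ m → t (suc m)) n
prefix-suc t zero    = refl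
prefix-suc t (suc n) = cong (_∷ʳ t (suc n)) (prefix-suc t n)

prefix-agrees : ∀ t l → (∀ n → n < length l → t n ≡ nth l n) → prefix t (length l) ≡ l
prefix-agrees t []      _     = refl
prefix-agrees t (d ∷ l) agree =
  trans (prefix-suc t (length l))
        (cong₂ _∷_ (agree 0 (s≤s z≤n)) (prefix-agrees _ l (λ n n< → agree (suc n) (s≤s n<))))

module _ {A : EqStr} {t : Text} (text : IsTextFor A t) where

  text-datum : ∀ n → DatumIn A (t n)
  text-datum n with t n in eq
  ... | nothing      = tt
  ... | just (x , y) = proj₁ text n x y eq

  prefix-describes : ∀ n → Describes A (prefix t n)
  prefix-describes zero    = []
  prefix-describes (suc n) = All.++⁺ (prefix-describes n) (text-datum n ∷ [])

module Interleaving (t : Text) (s₀ : FinSeq) (pad : FinSeq → FinSeq) where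

  stage : ℕ → FinSeq
  stage zero    = s₀
  stage (suc k) = stage k ++ t k ∷ pad (stage k ∷ʳ t k)

  interleave : Text
  interleave n = nth (stage (suc n)) n

  stage-≼ : ∀ {k k′} → k ≤ k′ → stage k ≼ stage k′
  stage-≼ = ≼-chain stage (λ k → ≼-++ (t k ∷ pad (stage k ∷ʳ t k)))

  stage-∷ʳ-≼ : ∀ k → stage k ∷ʳ t k ≼ stage (suc k)
  stage-∷ʳ-≼ k = pad (stage k ∷ʳ t k) , sym (++-assoc (stage k) (t k ∷ []) _)

  length-stage-< : ∀ k → length (stage k) < length (stage (suc k))
  length-stage-< k = subst (length (stage k) <_) (sym (length-++-sucʳ (stage k) (t k) _))
                       (s≤s (length-++-≤ˡ (stage k)))

  length-stage : ∀ k → k ≤ length (stage k)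
  length-stage zero    = z≤n
  length-stage (suc k) = ≤-trans (s≤s (length-stage k)) (length-stage-< k)

  interleave-nth : ∀ k {n} → n < length (stage k) → interleave n ≡ nth (stage k) n
  interleave-nth k {n} n< with ≤-total k (suc n)
  ... | inj₁ k≤ with stage-≼ k≤
  ...   | r , eq = trans (cong (λ σ → nth σ n) eq) (nth-++ˡ (stage k) r n<)
  interleave-nth k {n} n< | inj₂ ≤k with stage-≼ ≤k
  ...   | r , eq =
    sym (trans (cong (λ σ → nth σ n) eq) (nth-++ˡ (stage (suc n)) r (length-stage (suc n))))

  prefix-interleave : ∀ {l k} → l ≼ stage k → prefix interleave (length l) ≡ l
  prefix-interleave {l} {k} (r , eq) = prefix-agrees interleave l λ n n< →
    trans (interleave-nth k (subst (λ σ → n < length σ) (sym eq) (≤-trans n< (length-++-≤ˡ l))))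
          (trans (cong (λ σ → nth σ n) eq) (nth-++ˡ l r n<))

  converges-on-stages : ∀ {F : Learner} {N e l k} → (∀ n → N ≤ n → F (prefix interleave n) ≡ just e) →
                        l ≼ stage k → N ≤ length l → F l ≡ just e
  converges-on-stages {F} {k = k} conv l≼ N≤ =
    trans (cong F (sym (prefix-interleave {k = k} l≼))) (conv _ N≤)

  module _ {A} (text : IsTextFor A t) (d₀ : Describes A s₀)
           (padded : ∀ {l} → Describes A l → Describes A (l ++ pad l)) where

    stage-describes : ∀ k → Describes A (stage k)
    stage-describes zero    = d₀
    stage-describes (suc k) = subst (Describes A) (++-assoc (stage k) (t k ∷ []) _)
                                (padded (All.++⁺ (stage-describes k) (text-datum text k ∷ [])))

    interleave-text : IsTextFor A interleave
    interleave-text = sound , complete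
      where
      sound : ∀ n x y → interleave n ≡ just (x , y) → rel A x y ≡ true
      sound n x y eq = subst (DatumIn A) eq (nth-All tt (stage-describes (suc n)) n)

      complete : ∀ x y → rel A x y ≡ true → ∃[ n ] interleave n ≡ just (x , y)
      complete x y xy with proj₂ text x y xy
      ... | m , eq = length (stage m) ,
        trans (interleave-nth (suc m) (length-stage-< m))
              (trans (nth-length (stage m) (t m) _) eq)

-- Pauses carry no data, so they belong to the content of every sequence.
InContent : FinSeq → Datum → Set
InContent σ nothing  = ⊤
InContent σ (just p) = just p ∈ σ

infix 4 _⊆ᶜ_

_⊆ᶜ_ : FinSeq → FinSeq → Set
ρ ⊆ᶜ σ = All (InContent σ) ρ

⊆ᶜ-≼ : ∀ {ρ l σ} → ρ ⊆ᶜ l → l ≼ σ → ρ ⊆ᶜ σ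
⊆ᶜ-≼ ρ⊆ l≼σ = All.map (λ {d} → grow d) ρ⊆
  where
  grow : ∀ d → InContent _ d → InContent _ d
  grow nothing  _  = tt
  grow (just _) d∈ = ∈-≼ d∈ l≼σ

⊆ᶜ-describes : ∀ {A ρ σ} → ρ ⊆ᶜ σ → Describes A σ → Describes A ρ
⊆ᶜ-describes {A} ρ⊆ dσ = All.map (λ {d} → datum d) ρ⊆
  where
  datum : ∀ d → InContent _ d → DatumIn A d
  datum nothing  _  = tt
  datum (just _) d∈ = All.lookup dσ d∈

content-in-prefix : ∀ {A t} → IsTextFor A t → ∀ {ρ} → Describes A ρ → ∃[ N ] ρ ⊆ᶜ prefix t N
content-in-prefix text []                 = 0 , []
content-in-prefix text {nothing ∷ ρ} (_ ∷ dρ) with content-in-prefix text dρ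
... | N , ρ⊆ = N , tt ∷ ρ⊆
content-in-prefix {t = t} text {just (x , y) ∷ ρ} (xy ∷ dρ)
  with proj₂ text x y xy | content-in-prefix text dρ
... | m , tm≡ | N , ρ⊆ =
  suc m ⊔ N , ∈-≼ (∈-++⁺ʳ (prefix t m) (here (sym tm≡))) (prefix-≼ t (m≤m⊔n (suc m) N))
              ∷ ⊆ᶜ-≼ ρ⊆ (prefix-≼ t (m≤n⊔m (suc m) N))

sequencesUpTo : {X : Set} → List X → ℕ → List (List X)
sequencesUpTo D zero    = [] ∷ []
sequencesUpTo D (suc j) = [] ∷ cartesianProductWith _∷_ D (sequencesUpTo D j)

sequencesUpTo-complete : ∀ {X : Set} {D : List X} {l j} →
                         All (_∈ D) l → length l ≤ j → l ∈ sequencesUpTo D j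
sequencesUpTo-complete {j = zero}  []         _         = here refl
sequencesUpTo-complete {j = suc j} []         _         = here refl
sequencesUpTo-complete {j = suc j} (x∈ ∷ l∈) (s≤s l≤j) =
  there (∈-cartesianProductWith⁺ _∷_ x∈ (sequencesUpTo-complete l∈ l≤j))

datumSize : Datum → ℕ
datumSize nothing        = 0
datumSize (just (x , y)) = suc (x ⊔ y)

size : FinSeq → ℕ
size []      = 0
size (d ∷ σ) = suc (datumSize d ⊔ size σ)

data≤size : ∀ σ → All (λ d → datumSize d ≤ size σ) σ
data≤size []      = []
data≤size (d ∷ σ) = m≤n⇒m≤1+n (m≤m⊔n _ _)
                  ∷ All.map (λ ≤size → m≤n⇒m≤1+n (≤-trans ≤size (m≤n⊔m _ _))) (data≤size σ)

length≤size : ∀ σ → length σ ≤ size σ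
length≤size []      = z≤n
length≤size (d ∷ σ) = s≤s (≤-trans (length≤size σ) (m≤n⊔m _ _))

dataBelow : ℕ → List Datum
dataBelow k = nothing ∷ map just (cartesianProduct (upTo k) (upTo k))

dataBelow-complete : ∀ {k} d → datumSize d ≤ k → d ∈ dataBelow k
dataBelow-complete nothing        _ = here refl
dataBelow-complete (just (x , y)) s≤k = there (∈-map⁺ just (∈-cartesianProduct⁺
  (∈-upTo⁺ (≤-trans (s≤s (m≤m⊔n x y)) s≤k)) (∈-upTo⁺ (≤-trans (s≤s (m≤n⊔m x y)) s≤k))))

candidates : ℕ → List FinSeq
candidates zero    = []
candidates (suc k) = candidates k ++ sequencesUpTo (dataBelow k) k

candidates-≼ : ∀ {k k′} → k ≤ k′ → candidates k ≼ candidates k′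
candidates-≼ = ≼-chain candidates (λ k → ≼-++ (sequencesUpTo (dataBelow k) k))

candidates-complete : ∀ σ → σ ∈ candidates (suc (size σ))
candidates-complete σ = ∈-++⁺ʳ (candidates (size σ)) (sequencesUpTo-complete
  (All.map (λ {d} → dataBelow-complete d) (data≤size σ)) (length≤size σ))

ConvergesTo : Learner → Text → ℕ → Set
ConvergesTo F t e = ∃[ N ] (∀ n → N ≤ n → F (prefix t n) ≡ just e)

≅-refl : ∀ {A} → A ≅ A
≅-refl = id , bijective _≡_ , λ _ _ → refl

module TextLockingLearner (lem : ExcludedMiddle 0ℓ) (M : Learner) where

  Locks : FinSeq → FinSeq → Set
  Locks σ τ = τ ⊆ᶜ σ × (∀ ρ → ρ ⊆ᶜ σ → M (τ ++ ρ) ≡ M τ)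

  locks? : ∀ σ → Decidable (Locks σ)
  locks? σ τ = lem

  firstLocking : FinSeq → Maybe FinSeq
  firstLocking σ = find (locks? σ) (candidates (length σ))

  firstLocking-locks : ∀ {σ τ} → firstLocking σ ≡ just τ → Locks σ τ
  firstLocking-locks {σ} = find-sound (locks? σ) {candidates (length σ)}

  conjecture : {a b : Maybe FinSeq} → Dec (a ≡ b) → Maybe ℕ
  conjecture {a} (yes _) = a >>= M
  conjecture     (no _)  = nothing

  -- Answering only when the choice of τ survived the last datum makes convergence of M′
  -- force firstLocking to stabilise.
  M′ : Learner
  M′ σ = conjecture (lem {firstLocking σ ≡ firstLocking (dropLast σ)})

  conjecture-≡ : ∀ {τ a b} (a≟b : Dec (a ≡ b)) → a ≡ just τ → b ≡ just τ → conjecture a≟b ≡ M τ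
  conjecture-≡ (yes _)   refl _  = refl
  conjecture-≡ (no a≢b) a≡ b≡ = ⊥-elim (a≢b (trans a≡ (sym b≡)))

  conjecture-defined : ∀ {a b e} (a≟b : Dec (a ≡ b)) → conjecture a≟b ≡ just e →
                       ∃ λ τ → a ≡ just τ × b ≡ just τ
  conjecture-defined {just τ}  (yes refl) _ = τ , refl , refl
  conjecture-defined {nothing} (yes _)    ()
  conjecture-defined           (no _)     ()

  M′-stable : ∀ {σ τ} → firstLocking σ ≡ just τ → firstLocking (dropLast σ) ≡ just τ → M′ σ ≡ M τ
  M′-stable = conjecture-≡ lem

  M′-converges⇒firstLocking-stabilises : ∀ {t N e} → (∀ n → N ≤ n → M′ (prefix t n) ≡ just e) →
                                         ∃ λ τ → ∀ n → N ≤ n → firstLocking (prefix t n) ≡ just τ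
  M′-converges⇒firstLocking-stabilises {t} {N} conv with conjecture-defined lem (conv N ≤-refl)
  ... | τ , found , _ = τ , stable
    where
    stable : ∀ n → N ≤ n → firstLocking (prefix t n) ≡ just τ
    stable n N≤n with m≤n⇒m<n∨m≡n N≤n
    ... | inj₂ refl = found
    stable (suc n) _ | inj₁ (s≤s N≤n) with conjecture-defined lem (conv (suc n) (m≤n⇒m≤1+n N≤n))
    ... | τ′ , now , before =
      trans now (trans (sym before)
                (trans (cong firstLocking (dropLast-∷ʳ (prefix t n) (t n))) (stable n N≤n)))

  module OnText {A : EqStr} {t : Text} (text : IsTextFor A t) where

    Locking : FinSeq → Set
    Locking = WeakTextLocking M A

    Eventually : (FinSeq → Set) → Set
    Eventually P = ∃[ N ] (∀ σ → prefix t N ≼ σ → Describes A σ → P σ)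

    eventually-map : ∀ {P Q : FinSeq → Set} → (∀ {σ} → P σ → Q σ) → Eventually P → Eventually Q
    eventually-map f (N , p) = N , λ σ ≼σ dσ → f (p σ ≼σ dσ)

    eventually-both : ∀ {P Q : FinSeq → Set} → Eventually P → Eventually Q → Eventually (λ σ → P σ × Q σ)
    eventually-both (N₁ , p) (N₂ , q) = N₁ ⊔ N₂ , λ σ ≼σ dσ →
      p σ (≼-trans (prefix-≼ t (m≤m⊔n N₁ N₂)) ≼σ) dσ ,
      q σ (≼-trans (prefix-≼ t (m≤n⊔m N₁ N₂)) ≼σ) dσ

    eventually-long : ∀ k → Eventually (λ σ → k ≤ length σ)
    eventually-long k = k , λ σ ≼σ _ → subst (_≤ length σ) (prefix-length t k) (≼-length ≼σ)

    eventually-dropLast : ∀ {P : FinSeq → Set} → Eventually P → Eventually (λ σ → P (dropLast σ))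
    eventually-dropLast (N , p) = suc N , λ σ ≼σ dσ → p (dropLast σ) (dropLast-≼ ≼σ) (dropLast-All dσ)

    eventually-on-prefixes : ∀ {P : FinSeq → Set} → Eventually P → ∃[ N ] (∀ n → N ≤ n → P (prefix t n))
    eventually-on-prefixes (N , p) =
      N , λ n N≤n → p (prefix t n) (prefix-≼ t N≤n) (prefix-describes text n)

    eventually-constant⇒locking : ∀ {F : Learner} {c} → Eventually (λ σ → F σ ≡ c) →
                                  ∃[ n ] WeakTextLocking F A (prefix t n)
    eventually-constant⇒locking (N , const) =
      N , dN , λ ρ d → trans (const _ (≼-++ ρ) d) (sym (const _ ≼-refl dN))
      where dN = prefix-describes text N

    locking⇒eventually-locks : ∀ {τ} → Locking τ → Eventually (λ σ → Locks σ τ)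
    locking⇒eventually-locks (dτ , locked) with content-in-prefix text dτ
    ... | N , τ⊆ = N , λ σ ≼σ dσ →
      ⊆ᶜ-≼ τ⊆ ≼σ , λ ρ ρ⊆ → locked ρ (All.++⁺ dτ (⊆ᶜ-describes ρ⊆ dσ))

    frequently-locks⇒locking : ∀ {τ} → (∀ N → ∃ λ σ → prefix t N ≼ σ × Describes A σ × Locks σ τ) →
                               Locking τ
    frequently-locks⇒locking {τ} often = describes , locked
      where
      describes : Describes A τ
      describes = let _ , _ , dσ , τ⊆ , _ = often 0 in ⊆ᶜ-describes τ⊆ dσ

      locked : ∀ ρ → Describes A (τ ++ ρ) → M (τ ++ ρ) ≡ M τ
      locked ρ d with content-in-prefix text (All.++⁻ʳ τ d)
      ... | N , ρ⊆ = let _ , ≼σ , _ , _ , stays = often N in stays ρ (⊆ᶜ-≼ ρ⊆ ≼σ)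

    locks-on-prefixes⇒locking : ∀ {τ N} → (∀ n → N ≤ n → Locks (prefix t n) τ) → Locking τ
    locks-on-prefixes⇒locking {N = N} locks = frequently-locks⇒locking λ N′ →
      prefix t (N ⊔ N′) , prefix-≼ t (m≤n⊔m N N′) , prefix-describes text (N ⊔ N′) ,
      locks _ (m≤m⊔n N N′)

    locking-or-eventually-rejected : ∀ τ → Locking τ ⊎ Eventually (λ σ → ¬ Locks σ τ)
    locking-or-eventually-rejected τ with lem {Eventually (λ σ → ¬ Locks σ τ)}
    ... | yes rejected = inj₂ rejected
    ... | no ¬rejected = inj₁ (frequently-locks⇒locking often)
      where
      often : ∀ N → ∃ λ σ → prefix t N ≼ σ × Describes A σ × Locks σ τ
      often N = decidable-stable lem λ never →
        ¬rejected (N , λ σ ≼σ dσ locks → never (σ , ≼σ , dσ , locks))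

    eventually-accepted : ∀ {τ L} → Locking τ → Eventually (λ σ → find (locks? σ) (τ ∷ L) ≡ just τ)
    eventually-accepted {L = L} locking =
      eventually-map (λ {σ} → find-accept (locks? σ) {l = L}) (locking⇒eventually-locks locking)

    eventually-find : ∀ {L} → Any Locking L →
                      ∃ λ τ → Locking τ × Eventually (λ σ → find (locks? σ) L ≡ just τ)
    eventually-find {τ ∷ L} (here locking) = τ , locking , eventually-accepted {L = L} locking
    eventually-find {τ ∷ L} (there lockingInL) with locking-or-eventually-rejected τ
    ... | inj₁ locking  = τ , locking , eventually-accepted {L = L} locking
    ... | inj₂ rejected with eventually-find lockingInL
    ...   | τ′ , locking′ , found =
      τ′ , locking′ , eventually-map (λ {σ} (r , f) → trans (find-reject (locks? σ) {l = L} r) f)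
                                     (eventually-both rejected found)

    eventually-firstLocking : ∃ Locking →
                              ∃ λ τ → Locking τ × Eventually (λ σ → firstLocking σ ≡ just τ)
    eventually-firstLocking (τ₀ , locking₀) with eventually-find (lose (candidates-complete τ₀) locking₀)
    ... | τ , locking , found = τ , locking , eventually-map
      (λ {σ} (f , k≤) → find-≼ (locks? σ) f (candidates-≼ k≤))
      (eventually-both found (eventually-long (suc (size τ₀))))

    eventually-M′ : ∀ {τ} → Eventually (λ σ → firstLocking σ ≡ just τ) → Eventually (λ σ → M′ σ ≡ M τ)
    eventually-M′ found = eventually-map (λ {σ} (now , before) → M′-stable {σ} now before)
                                         (eventually-both found (eventually-dropLast found))

    Breaks : FinSeq → FinSeq → Set
    Breaks l ρ = Describes A (l ++ ρ) × M (l ++ ρ) ≢ M l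

    breakOf : ∀ {l} → Dec (∃ (Breaks l)) → FinSeq
    breakOf (yes (ρ , _)) = ρ
    breakOf (no _)        = []

    break : FinSeq → FinSeq
    break l = breakOf (lem {∃ (Breaks l)})

    -- Without locking sequences, inserting a break after every datum of t yields a text for A
    -- on which M changes its mind infinitely often.
    module _ (no-locking : ¬ ∃ Locking) where

      breakOf-breaks : ∀ {l} → Describes A l → (b? : Dec (∃ (Breaks l))) → Breaks l (breakOf b?)
      breakOf-breaks _  (yes (_ , breaks)) = breaks
      breakOf-breaks dl (no ¬breaks) =
        ⊥-elim (no-locking (_ , dl , λ ρ d → decidable-stable lem λ ne → ¬breaks (ρ , d , ne)))

      break-breaks : ∀ {l} → Describes A l → Breaks l (break l)
      break-breaks dl = breakOf-breaks dl lem

      open Interleaving t [] break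

      breaking-text : IsTextFor A interleave
      breaking-text = interleave-text text [] (proj₁ ∘ break-breaks)

      breaking-diverges : ∀ e → ¬ ConvergesTo M interleave e
      breaking-diverges e (N , conv) =
        proj₂ (break-breaks dl) (trans (cong M (sym (proj₂ (stage-∷ʳ-≼ N)))) (trans after (sym before)))
        where
        l = stage N ∷ʳ t N
        dl : Describes A l
        dl = ≼-All (stage-∷ʳ-≼ N) (stage-describes text [] (proj₁ ∘ break-breaks) (suc N))
        after : M (stage (suc N)) ≡ just e
        after = converges-on-stages {F = M} conv ≼-refl (≤-trans (n≤1+n N) (length-stage (suc N)))
        before : M l ≡ just e
        before = converges-on-stages {F = M} conv (stage-∷ʳ-≼ N)
                                     (≤-trans (length-stage N) (length-++-≤ˡ (stage N)))

    locking-exists : (∀ t′ → IsTextFor A t′ → ∃ (ConvergesTo M t′)) → ∃ Locking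
    locking-exists converges = decidable-stable lem λ no-locking →
      let e , conv = converges _ (breaking-text no-locking) in breaking-diverges no-locking e conv

    locking-value : ∀ {τ} {P : ℕ → Set} → Locking τ →
                    (∀ t′ → IsTextFor A t′ → ∃[ e ] (ConvergesTo M t′ e × P e)) →
                    ∃[ e ] (M τ ≡ just e × P e)
    locking-value {τ} (dτ , locked) learns =
      let e , (N , conv) , Pe = learns interleave (interleave-text text dτ (λ dl → All.++⁺ dl []))
      in e , trans (sym (locked (prefix t N) (All.++⁺ dτ (prefix-describes text N))))
                   (trans (cong M (sym (stage≡ N)))
                          (converges-on-stages {F = M} {k = N} conv ≼-refl (length-stage N))) , Pe
      where
      open Interleaving t τ (λ _ → [])
      stage≡ : ∀ k → stage k ≡ τ ++ prefix t k
      stage≡ zero    = sym (++-identityʳ τ)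
      stage≡ (suc k) = trans (cong (_∷ʳ t k) (stage≡ k)) (++-assoc τ (prefix t k) (t k ∷ []))

  M′-learns : ∀ {Ms _∼_ A₀} → TxtExLearns Ms _∼_ M A₀ → TxtExLearns Ms _∼_ M′ A₀
  M′-learns learns A iso t text =
    let τ , locking , found = eventually-firstLocking (locking-exists λ t′ text′ →
                                let e , conv , _ = learns A iso t′ text′ in e , conv)
        e , Mτ≡e , A∼e = locking-value locking (learns A iso)
        N , M′≡ = eventually-on-prefixes (eventually-M′ found)
    in e , (N , λ n N≤n → trans (M′≡ n N≤n) Mτ≡e) , A∼e
    where open OnText {A} {t} text

  M′-textLocking : ∀ {Ms _∼_} → TextLocking Ms _∼_ M′
  M′-textLocking A learns t text =
    let e , (N , conv) , _ = learns A (≅-refl {A}) t text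
        τ , stable = M′-converges⇒firstLocking-stabilises conv
        locking = locks-on-prefixes⇒locking λ n N≤n → firstLocking-locks (stable n N≤n)
        _ , _ , found = eventually-firstLocking (τ , locking)
    in eventually-constant⇒locking (eventually-M′ found)
    where open OnText {A} {t} text

mainTheorem12 : ExcludedMiddle 0ℓ →
    (Ms : ℕ → EqStr) (_∼_ : EqStr → EqStr → Set) → IsEquivalence _∼_ →
    (M : Learner) →
    ∃[ M' ] (TextLocking Ms _∼_ M' ×
             (∀ (A : EqStr) → TxtExLearns Ms _∼_ M A → TxtExLearns Ms _∼_ M' A))
mainTheorem12 lem Ms _∼_ _ M = M′ , M′-textLocking {Ms} {_∼_} , λ A → M′-learns {Ms} {_∼_} {A}
  where open TextLockingLearner lem M
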